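{- Let $a,b,c,d$ be integers with $a,b,c$ odd and $d$ even, such that both $R\left(ax+by+cz=\frac{d}{2},2\right)$ and $R(ax+by+cz=d,\mathbb{Z}/3\mathbb{Z})$ exist. Then \[2R\left(ax+by+cz=\tfrac{d}{2},2\right)\leq R(ax+by+cz=d,\mathbb{Z}/3\mathbb{Z}).\]
   Context: $[1,n]=\{1,\dots,n\}$. For an equation $\mathcal{L}$ in three variables $x,y,z$ and a coloring $\chi:[1,n]\to\{0,\dots,r-1\}$, a solution $(x_1,x_2,x_3)\in[1,n]^3$ is monochromatic if all $\chi(x_i)$ are equal, and zero-sum (for $r=3$) if $\chi(x_1)+\chi(x_2)+\chi(x_3)\equiv0\pmod 3$. $R(\mathcal{L},2)$ is the least $N$ (if it exists) such that for all $n\ge N$ every $2$-coloring of $[1,n]$ has a monochromatic solution of $\mathcal{L}$; $R(\mathcal{L},\mathbb{Z}/3\mathbb{Z})$ is the least $N$ (if it exists) such that for all $n\ge N$ every map $[1,n]\to\{0,1,2\}$ has a zero-sum solution of $\mathcal{L}$. -}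

module Defs where

open import Data.Nat using (ℕ; _≤_; _<_)
open import Data.Integer using (ℤ; +_; _+_; _*_)
open import Data.Fin using (Fin)
open import Data.Product using (Σ; _×_; ∃)
open import Relation.Binary.PropositionalEquality using (_≡_)
open import Relation.Nullary using (¬_)

InRange : ℕ → ℕ → Set
InRange n x = 1 ≤ x × x ≤ n

Solves : ℤ → ℤ → ℤ → ℤ → ℕ → ℕ → ℕ → Set
Solves a b c d x y z = a * + x + b * + y + c * + z ≡ d

SolIn : ℤ → ℤ → ℤ → ℤ → ℕ → ℕ → ℕ → ℕ → Set
SolIn a b c d n x y z = InRange n x × InRange n y × InRange n z × Solves a b c d x y z

-- every 2-colouring of [1,n] has a monochromatic solution
-- (a colouring of [1,n] is represented by a map ℕ → Fin 2; only values on [1,n] matter)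
Mono2 : ℤ → ℤ → ℤ → ℤ → ℕ → Set
Mono2 a b c d n = (χ : ℕ → Fin 2) →
  Σ ℕ λ x → Σ ℕ λ y → Σ ℕ λ z → SolIn a b c d n x y z × χ x ≡ χ y × χ y ≡ χ z

ZeroSum3 : ℤ → ℤ → ℤ → ℤ → ℕ → Set
ZeroSum3 a b c d n = (χ : ℕ → Fin 3) →
  Σ ℕ λ x → Σ ℕ λ y → Σ ℕ λ z → SolIn a b c d n x y z ×
    (Data.Fin.toℕ (χ x) Data.Nat.+ Data.Fin.toℕ (χ y) Data.Nat.+ Data.Fin.toℕ (χ z)) Data.Nat.% 3 ≡ 0
  where import Data.Fin; import Data.Nat

IsLeastThreshold : (ℕ → Set) → ℕ → Set
IsLeastThreshold P N = ((n : ℕ) → N ≤ n → P n) × ((M : ℕ) → M < N → ¬ ((n : ℕ) → M ≤ n → P n))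

IsR2 : ℤ → ℤ → ℤ → ℤ → ℕ → Set
IsR2 a b c d = IsLeastThreshold (Mono2 a b c d)

IsRZ3 : ℤ → ℤ → ℤ → ℤ → ℕ → Set
IsRZ3 a b c d = IsLeastThreshold (ZeroSum3 a b c d)

Odd : ℤ → Set
Odd a = ∃ λ k → a ≡ + 2 * k + + 1

-- Colour [1,2k+1] from a 2-colouring χ of [1,k] by giving 2m the colour χ m ∈ {0,1} and every
-- odd number the colour 2. As a, b, c are odd and d is even, a solution of a x + b y + c z = d has
-- an even number of odd entries; two odd entries would give colour sum 4 + χ m ≢ 0 (mod 3). So a
-- zero-sum solution is (2x′, 2y′, 2z′) with χ x′ + χ y′ + χ z′ ≡ 0 (mod 3), i.e. χ constant on
-- it, and (x′, y′, z′) solves the halved equation. Hence R(d, ℤ/3ℤ) ≤ 2k + 1 forces R(d/2, 2) ≤ k.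
module Submission where

open import Defs
open import Data.Nat using (ℕ; _≤_; _*_)
open import Data.Integer using (ℤ; +_) renaming (_*_ to _*ℤ_)
open import Relation.Binary.PropositionalEquality using (_≡_)

open import Data.Nat as ℕ using (suc; _+_; _<_; NonZero; parity; ⌊_/2⌋; z≤n; s≤s)
open import Data.Nat.Properties as ℕ using (≮⇒≥)
open import Data.Integer as ℤ using (-[1+_]) renaming (_+_ to _+ℤ_; _-_ to _-ℤ_; -_ to -ℤ_)
import Data.Integer.Properties as ℤ
open import Data.Integer.Tactic.RingSolver using (solve-∀)
open import Data.Parity as ℙ using (Parity; 0ℙ; 1ℙ)
import Data.Parity.Properties as ℙ
open import Data.Fin using (Fin; zero; suc; toℕ; inject₁; #_)
open import Data.Product using (_×_; _,_)
open import Data.Sum using (inj₁; inj₂)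
open import Relation.Nullary using (¬_)
open import Relation.Binary.PropositionalEquality
  using (refl; sym; trans; cong; cong₂; module ≡-Reasoning)

private
  variable
    a b c e : ℤ
    x y z n k : ℕ

parity-+₃ : ∀ x y z → parity (x + y + z) ≡ parity x ℙ.+ parity y ℙ.+ parity z
parity-+₃ x y z = trans (ℙ.+-homo-+ (x + y) z) (cong (ℙ._+ parity z) (ℙ.+-homo-+ x y))

+n≡2t⇒even : ∀ {t} → + n ≡ + 2 *ℤ t → parity n ≡ 0ℙ
+n≡2t⇒even {n} {+ s} eq = begin
  parity n       ≡⟨ cong parity (ℤ.+-injective (trans eq (sym (ℤ.pos-* 2 s)))) ⟩
  parity (2 * s) ≡⟨ ℙ.*-homo-* 2 s ⟩
  0ℙ             ∎
  where open ≡-Reasoning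
+n≡2t⇒even {t = -[1+ s ]} ()

even⇒2*⌊n/2⌋≡n : parity n ≡ 0ℙ → 2 * ⌊ n /2⌋ ≡ n
even⇒2*⌊n/2⌋≡n {0}           _  = refl
even⇒2*⌊n/2⌋≡n {suc (suc n)} ev =
  trans (ℕ.*-suc 2 ⌊ n /2⌋) (cong (λ m → suc (suc m)) (even⇒2*⌊n/2⌋≡n ev))

odd-coefficients-mod-2 : ∀ k l m X Y Z →
  X +ℤ Y +ℤ Z ≡
  ((+ 2 *ℤ k +ℤ + 1) *ℤ X +ℤ (+ 2 *ℤ l +ℤ + 1) *ℤ Y +ℤ (+ 2 *ℤ m +ℤ + 1) *ℤ Z)
    -ℤ + 2 *ℤ (k *ℤ X +ℤ l *ℤ Y +ℤ m *ℤ Z)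
odd-coefficients-mod-2 = solve-∀

solution-sum-even : Odd a → Odd b → Odd c → Solves a b c (+ 2 *ℤ e) x y z →
                    parity (x + y + z) ≡ 0ℙ
solution-sum-even {e = e} {x} {y} {z} (k , refl) (l , refl) (m , refl) sol =
  +n≡2t⇒even (begin
    + (x + y + z)               ≡⟨ ℤ.pos-+ (x + y) z ⟩
    + (x + y) +ℤ + z            ≡⟨ cong (_+ℤ + z) (ℤ.pos-+ x y) ⟩
    + x +ℤ + y +ℤ + z           ≡⟨ odd-coefficients-mod-2 k l m (+ x) (+ y) (+ z) ⟩
    lhs -ℤ + 2 *ℤ t             ≡⟨ cong (_-ℤ + 2 *ℤ t) sol ⟩
    + 2 *ℤ e -ℤ + 2 *ℤ t        ≡⟨ cong (+ 2 *ℤ e +ℤ_) (ℤ.neg-distribʳ-* (+ 2) t) ⟩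
    + 2 *ℤ e +ℤ + 2 *ℤ (-ℤ t)   ≡⟨ ℤ.*-distribˡ-+ (+ 2) e (-ℤ t) ⟨
    + 2 *ℤ (e -ℤ t)             ∎)
  where
  open ≡-Reasoning
  t = k *ℤ + x +ℤ l *ℤ + y +ℤ m *ℤ + z
  lhs = (+ 2 *ℤ k +ℤ + 1) *ℤ + x +ℤ (+ 2 *ℤ l +ℤ + 1) *ℤ + y +ℤ (+ 2 *ℤ m +ℤ + 1) *ℤ + z

*-distribˡ-linear₃ : ∀ k a b c X Y Z →
  k *ℤ (a *ℤ X +ℤ b *ℤ Y +ℤ c *ℤ Z) ≡ a *ℤ (k *ℤ X) +ℤ b *ℤ (k *ℤ Y) +ℤ c *ℤ (k *ℤ Z)
*-distribˡ-linear₃ = solve-∀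

solves-cancelˡ : ∀ k .{{_ : NonZero k}} {x′ y′ z′} → Solves a b c (+ k *ℤ e) x y z →
                 k * x′ ≡ x → k * y′ ≡ y → k * z′ ≡ z → Solves a b c e x′ y′ z′
solves-cancelˡ {a} {b} {c} {e} k {x′} {y′} {z′} sol refl refl refl =
  ℤ.*-cancelˡ-≡ (+ k) _ _ (begin
    + k *ℤ (a *ℤ + x′ +ℤ b *ℤ + y′ +ℤ c *ℤ + z′)
      ≡⟨ *-distribˡ-linear₃ (+ k) a b c (+ x′) (+ y′) (+ z′) ⟩
    a *ℤ (+ k *ℤ + x′) +ℤ b *ℤ (+ k *ℤ + y′) +ℤ c *ℤ (+ k *ℤ + z′)
      ≡⟨ cong₂ _+ℤ_ (cong₂ _+ℤ_ (scaled a x′) (scaled b y′)) (scaled c z′) ⟨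
    a *ℤ + (k * x′) +ℤ b *ℤ + (k * y′) +ℤ c *ℤ + (k * z′)
      ≡⟨ sol ⟩
    + k *ℤ e ∎)
  where
  open ≡-Reasoning
  scaled : ∀ a x → a *ℤ + (k * x) ≡ a *ℤ (+ k *ℤ + x)
  scaled a x = cong (a *ℤ_) (ℤ.pos-* k x)

halve-inRange : ∀ {h} → InRange (suc (2 * n)) x → 2 * h ≡ x → InRange n h
halve-inRange {n} {h = 0}     (() , _)   refl
halve-inRange {n} {h = suc h} (_ , 2h≤) refl = s≤s z≤n , ℕ.m<1+n⇒m≤n (ℕ.*-cancelˡ-< 2 _ _ 2h<)
  where
  2h< : 2 * suc h < 2 * suc n
  2h< = ℕ.≤-trans (s≤s 2h≤) (ℕ.≤-reflexive (sym (ℕ.*-suc 2 n)))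

liftColour : Parity → Fin 2 → Fin 3
liftColour 0ℙ u = inject₁ u
liftColour 1ℙ _ = # 2

liftColouring : (ℕ → Fin 2) → ℕ → Fin 3
liftColouring χ n = liftColour (parity n) (χ ⌊ n /2⌋)

ZeroSum : Fin 3 → Fin 3 → Fin 3 → Set
ZeroSum u v w = (toℕ u + toℕ v + toℕ w) ℕ.% 3 ≡ 0

zeroSum-liftColour : ∀ p q r (u v w : Fin 2) → p ℙ.+ q ℙ.+ r ≡ 0ℙ →
                     ZeroSum (liftColour p u) (liftColour q v) (liftColour r w) →
                     (p ≡ 0ℙ × q ≡ 0ℙ × r ≡ 0ℙ) × u ≡ v × v ≡ w
zeroSum-liftColour 0ℙ 0ℙ 0ℙ zero       zero       zero       _ _  = (refl , refl , refl) , refl , refl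
zeroSum-liftColour 0ℙ 0ℙ 0ℙ (suc zero) (suc zero) (suc zero) _ _  = (refl , refl , refl) , refl , refl
zeroSum-liftColour 0ℙ 0ℙ 0ℙ zero       zero       (suc zero) _ ()
zeroSum-liftColour 0ℙ 0ℙ 0ℙ zero       (suc zero) zero       _ ()
zeroSum-liftColour 0ℙ 0ℙ 0ℙ zero       (suc zero) (suc zero) _ ()
zeroSum-liftColour 0ℙ 0ℙ 0ℙ (suc zero) zero       zero       _ ()
zeroSum-liftColour 0ℙ 0ℙ 0ℙ (suc zero) zero       (suc zero) _ ()
zeroSum-liftColour 0ℙ 0ℙ 0ℙ (suc zero) (suc zero) zero       _ ()
zeroSum-liftColour 0ℙ 1ℙ 1ℙ zero       _          _          _ ()
zeroSum-liftColour 0ℙ 1ℙ 1ℙ (suc zero) _          _          _ ()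
zeroSum-liftColour 1ℙ 0ℙ 1ℙ _          zero       _          _ ()
zeroSum-liftColour 1ℙ 0ℙ 1ℙ _          (suc zero) _          _ ()
zeroSum-liftColour 1ℙ 1ℙ 0ℙ _          _          zero       _ ()
zeroSum-liftColour 1ℙ 1ℙ 0ℙ _          _          (suc zero) _ ()
zeroSum-liftColour 0ℙ 0ℙ 1ℙ _ _ _ () _
zeroSum-liftColour 0ℙ 1ℙ 0ℙ _ _ _ () _
zeroSum-liftColour 1ℙ 0ℙ 0ℙ _ _ _ () _
zeroSum-liftColour 1ℙ 1ℙ 1ℙ _ _ _ () _

zeroSum⇒mono : Odd a → Odd b → Odd c → ∀ n →
               ZeroSum3 a b c (+ 2 *ℤ e) (suc (2 * n)) → Mono2 a b c e n
zeroSum⇒mono {a} {b} {c} oa ob oc n zeroSum χ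
  with x , y , z , (x∈ , y∈ , z∈ , sol) , colourSum ← zeroSum (liftColouring χ)
  with (ex , ey , ez) , χx≡χy , χy≡χz ←
         zeroSum-liftColour (parity x) (parity y) (parity z) (χ ⌊ x /2⌋) (χ ⌊ y /2⌋) (χ ⌊ z /2⌋)
           (trans (sym (parity-+₃ x y z)) (solution-sum-even oa ob oc sol)) colourSum
  = ⌊ x /2⌋ , ⌊ y /2⌋ , ⌊ z /2⌋
  , ( halve-inRange x∈ (even⇒2*⌊n/2⌋≡n ex)
    , halve-inRange y∈ (even⇒2*⌊n/2⌋≡n ey)
    , halve-inRange z∈ (even⇒2*⌊n/2⌋≡n ez)
    , solves-cancelˡ {a = a} {b} {c} {x = x} {y} {z} 2 sol
        (even⇒2*⌊n/2⌋≡n ex) (even⇒2*⌊n/2⌋≡n ey) (even⇒2*⌊n/2⌋≡n ez))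
  , χx≡χy , χy≡χz

leastThreshold⇒¬pred : ∀ {P : ℕ → Set} → IsLeastThreshold P (suc k) → ¬ P k
leastThreshold⇒¬pred {k} {P} (above , least) Pk = least k (ℕ.n<1+n k) holdsFrom-k
  where
  holdsFrom-k : ∀ n → k ≤ n → P n
  holdsFrom-k n k≤n with ℕ.m≤n⇒m<n∨m≡n k≤n
  ... | inj₁ k<n  = above n k<n
  ... | inj₂ refl = Pk

theorem2 : (a b c d e : ℤ) → Odd a → Odd b → Odd c → d ≡ + 2 *ℤ e →
    (N M : ℕ) → IsR2 a b c e N → IsRZ3 a b c d M → 2 * N ≤ M
theorem2 a b c d e oa ob oc refl 0       M _  _ = z≤n
theorem2 a b c d e oa ob oc refl (suc k) M r2 (zeroSumFrom-M , _) = ≮⇒≥ λ M<2N →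
  leastThreshold⇒¬pred r2 (zeroSum⇒mono oa ob oc k (zeroSumFrom-M _ (M≤2k+1 M<2N)))
  where
  M≤2k+1 : M < 2 * suc k → M ≤ suc (2 * k)
  M≤2k+1 M<2N = ℕ.m<1+n⇒m≤n (ℕ.≤-trans M<2N (ℕ.≤-reflexive (ℕ.*-suc 2 k)))
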